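{- Let $q$ be a power of an odd prime with $q\equiv 3\pmod 4$. For any $u\in\mathbb{F}_q\setminus\{0,\pm1\}$, with $F_{2,u}(x)=x^2\big(1+u\eta(x)\big)$, we have $\delta_{F_{2,u}}(1,u+1)\le 4$ and $\delta_{F_{2,u}}(1,u-1)\le 4$.
   Context: $\eta$ is the quadratic character of $\mathbb{F}_q$ ($\eta(0)=0$, $\eta=1$ on nonzero squares, $-1$ on non-squares). $\delta_f(1,b)=\#\{x\in\mathbb{F}_q: f(x+1)-f(x)=b\}$. -}

module Defs where

open import Level using (Level; suc; _⊔_)
open import Data.Nat using (ℕ)
open import Data.Fin using (Fin)
open import Data.List using (List; length; filter)
open import Data.Bool.ListAction using (any)
open import Data.Fin.Base using ()
open import Data.List using (allFin)
open import Data.Bool using (Bool; true; false; if_then_else_)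
open import Data.Product using (Σ; _×_; ∃)
open import Relation.Nullary using (¬_; Dec; yes; no; does)
open import Relation.Binary.PropositionalEquality using (_≡_)
open import Relation.Binary.Definitions using (DecidableEquality)
open import Algebra.Structures using (IsCommutativeRing)
open import Function.Bundles using (_↔_; Inverse)

record FiniteField (q : ℕ) : Set₁ where
  infixl 7 _*_
  infixl 6 _+_ _-_
  field
    Carrier : Set
    _+_ _*_ : Carrier → Carrier → Carrier
    -_ : Carrier → Carrier
    0# 1# : Carrier
    isCommutativeRing : IsCommutativeRing _≡_ _+_ _*_ -_ 0# 1#
    0≢1 : ¬ (0# ≡ 1#)
    inverse : ∀ x → ¬ (x ≡ 0#) → Σ Carrier (λ y → x * y ≡ 1#)
    _≟_ : DecidableEquality Carrier
    enum : Fin q ↔ Carrier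

  _-_ : Carrier → Carrier → Carrier
  x - y = x + (- y)

  elt : Fin q → Carrier
  elt = Inverse.to enum

  isSquare : Carrier → Bool
  isSquare x = any (λ i → does ((elt i * elt i) ≟ x)) (allFin q)

  η : Carrier → Carrier
  η x with x ≟ 0#
  ... | yes _ = 0#
  ... | no _ = if isSquare x then 1# else - 1#

  δ₁ : (Carrier → Carrier) → Carrier → ℕ
  δ₁ f b = length (filter (λ i → (f (elt i + 1#) - f (elt i)) ≟ b) (allFin q))

  F₂ : Carrier → Carrier → Carrier
  F₂ u x = x * x * (1# + u * η x)

-- Write Δ x = F(x + 1) − F(x) with F = F_{2,u}. At x = 0 and x = −1 one of the
-- two characters vanishes and Δ is explicit, so Δ x = b picks out at most one of
-- these two points. Elsewhere η x and η (x + 1) are ±1, and in each of the four sign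
-- patterns Δ x − b factors: one pattern is impossible, one gives the quadratic
-- u x² + (u − 1) x + c = 0, and the remaining two give linear equations. These
-- linear cases force opposite quadratic characters of u (using that −1 is a
-- nonsquare and that η is multiplicative, both of which follow by counting from
-- q ≡ 3 (mod 4)), so only one of them can occur. Hence there are at most
-- 1 + 1 + 2 = 4 solutions.
module Submission where

open import Defs
open import Algebra.Bundles using (CommutativeRing)
import Algebra.Solver.Ring
import Algebra.Solver.Ring.AlmostCommutativeRing as ACR
open import Data.Bool.Base using (Bool; true; false; T)
open import Data.Empty using (⊥-elim)
open import Data.Fin.Base as Fin using (Fin; toℕ)
import Data.Fin.Properties as Fin
open import Data.Integer.Base using (ℤ)
import Data.Integer.Base as ℤ
import Data.Integer.Properties as ℤ
open import Data.List.Base using (List; []; _∷_; length; filter; allFin; lookup)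
open import Data.List.Properties using (filter-all; filter-none; filter-some; length-tabulate)
open import Data.List.Membership.Propositional using (_∈_)
open import Data.List.Membership.Propositional.Properties using (∈-filter⁺; ∈-filter⁻; ∈-allFin; ∈-lookup)
open import Data.List.Relation.Binary.Sublist.Propositional using (⊆-refl)
open import Data.List.Relation.Binary.Sublist.Propositional.Properties using (filter⁺; length-mono-≤)
open import Data.List.Relation.Unary.All as All using (All; _∷_)
open import Data.List.Relation.Unary.All.Properties using (all-filter)
open import Data.List.Relation.Unary.AllPairs using (_∷_)
import Data.List.Relation.Unary.Any as Any
open import Data.List.Relation.Unary.Any.Properties using (any⁺; any⁻; lookup-index)
open import Data.List.Relation.Unary.Unique.Propositional using (Unique)
import Data.List.Relation.Unary.Unique.Propositional.Properties as Unique
open import Data.Maybe.Base using (Maybe; just; nothing)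
open import Data.Nat.Base as ℕ using (ℕ; zero; suc; _≤_; _<_; z≤n; s≤s; _^_; _%_)
import Data.Nat.DivMod as ℕ
import Data.Nat.Properties as ℕ
open import Data.Nat.Primality using (Prime)
open import Data.Nat.Tactic.RingSolver using (solve-∀)
open import Data.Product.Base using (∃; _×_; _,_; proj₁; proj₂)
open import Data.Sign.Base as Sign using (Sign)
open import Data.Sum.Base using (_⊎_; inj₁; inj₂)
open import Data.Unit.Base using (tt)
open import Function.Base using (_∘_; case_of_)
open import Function.Bundles using (_↔_; Inverse)
open import Level using (0ℓ)
open import Relation.Binary.PropositionalEquality as ≡ using (_≡_; _≢_)
open import Relation.Nullary using (¬_; Dec; yes; no; contradiction)
open import Relation.Nullary.Decidable using (does; decidable-stable; dec-true; dec-false)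
open import Relation.Unary using (Pred; Decidable; U; _⊆_; _∪_; _∩_; ∁)
open import Relation.Unary.Properties using (U?; _∪?_; _∩?_; ∁?)

-- The normaliser can only cancel terms if it can decide equality of coefficients,
-- which an abstract carrier does not allow; so the coefficients are integers.
-- With the type-checking-optimised _×_, ⟦ + 0 ⟧ and ⟦ + 1 ⟧ reduce to 0# and 1#,
-- so the solver's equations match goals stated with 0# and 1# definitionally.
module IntegerCoefficientSolver {c ℓ} (R : CommutativeRing c ℓ) where
  open CommutativeRing R
  open import Algebra.Properties.Ring ring using (-1*x≈-x)
  open import Algebra.Properties.AbelianGroup +-abelianGroup using (⁻¹-∙-comm; ⁻¹-involutive; ε⁻¹≈ε)
  open import Algebra.Properties.CommutativeSemigroup +-commutativeSemigroup
    using () renaming (interchange to +-interchange)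
  open import Algebra.Properties.CommutativeSemigroup *-commutativeSemigroup
    using () renaming (interchange to *-interchange)
  open import Algebra.Properties.Semiring.Mult.TCOptimised semiring
    using (1+×; ×-homo-+; ×1-homo-*) renaming (_×_ to _×′_)
  open import Relation.Binary.Reasoning.Setoid setoid

  fromℕ : ℕ → Carrier
  fromℕ n = n ×′ 1#

  ⟦_⟧ : ℤ → Carrier
  ⟦ ℤ.+ n ⟧      = fromℕ n
  ⟦ ℤ.-[1+ n ] ⟧ = - fromℕ (suc n)

  private
    1+a-[1+b]≈a-b : ∀ a b → (1# + a) - (1# + b) ≈ a - b
    1+a-[1+b]≈a-b a b = begin
      (1# + a) + - (1# + b)   ≈⟨ +-congˡ (sym (⁻¹-∙-comm 1# b)) ⟩
      (1# + a) + (- 1# + - b) ≈⟨ +-interchange 1# a (- 1#) (- b) ⟩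
      (1# - 1#) + (a - b)     ≈⟨ +-congʳ (-‿inverseʳ 1#) ⟩
      0# + (a - b)            ≈⟨ +-identityˡ _ ⟩
      a - b                   ∎

    ⟦_⟧ₛ : Sign → Carrier
    ⟦ Sign.+ ⟧ₛ = 1#
    ⟦ Sign.- ⟧ₛ = - 1#

    ◃-homo : ∀ s n → ⟦ s ℤ.◃ n ⟧ ≈ ⟦ s ⟧ₛ * fromℕ n
    ◃-homo s      zero    = sym (zeroʳ _)
    ◃-homo Sign.+ (suc n) = sym (*-identityˡ _)
    ◃-homo Sign.- (suc n) = sym (-1*x≈-x _)

    sign-abs : ∀ i → ⟦ i ⟧ ≈ ⟦ ℤ.sign i ⟧ₛ * fromℕ ℤ.∣ i ∣
    sign-abs (ℤ.+ n)    = sym (*-identityˡ _)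
    sign-abs ℤ.-[1+ n ] = sym (-1*x≈-x _)

    sign-*-homo : ∀ s t → ⟦ s Sign.* t ⟧ₛ ≈ ⟦ s ⟧ₛ * ⟦ t ⟧ₛ
    sign-*-homo Sign.+ t      = sym (*-identityˡ _)
    sign-*-homo Sign.- Sign.+ = sym (*-identityʳ _)
    sign-*-homo Sign.- Sign.- = sym (trans (-1*x≈-x _) (⁻¹-involutive _))

  ⊖-homo : ∀ m n → ⟦ m ℤ.⊖ n ⟧ ≈ fromℕ m - fromℕ n
  ⊖-homo zero    zero    = sym (-‿inverseʳ 0#)
  ⊖-homo (suc m) zero    = sym (trans (+-congˡ ε⁻¹≈ε) (+-identityʳ _))
  ⊖-homo zero    (suc n) = sym (+-identityˡ _)
  ⊖-homo (suc m) (suc n) = begin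
    ⟦ suc m ℤ.⊖ suc n ⟧               ≡⟨ ≡.cong ⟦_⟧ (ℤ.[1+m]⊖[1+n]≡m⊖n m n) ⟩
    ⟦ m ℤ.⊖ n ⟧                       ≈⟨ ⊖-homo m n ⟩
    fromℕ m - fromℕ n                 ≈⟨ 1+a-[1+b]≈a-b (fromℕ m) (fromℕ n) ⟨
    (1# + fromℕ m) - (1# + fromℕ n)   ≈⟨ +-cong (1+× m 1#) (-‿cong (1+× n 1#)) ⟨
    fromℕ (suc m) - fromℕ (suc n)     ∎

  +-homo : ∀ i j → ⟦ i ℤ.+ j ⟧ ≈ ⟦ i ⟧ + ⟦ j ⟧
  +-homo (ℤ.+ m)    (ℤ.+ n)    = ×-homo-+ 1# m n
  +-homo (ℤ.+ m)    ℤ.-[1+ n ] = ⊖-homo m (suc n)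
  +-homo ℤ.-[1+ m ] (ℤ.+ n)    = trans (⊖-homo n (suc m)) (+-comm _ _)
  +-homo ℤ.-[1+ m ] ℤ.-[1+ n ] = begin
    - fromℕ (suc (suc (m ℕ.+ n)))        ≡⟨ ≡.cong (λ k → - fromℕ (suc k)) (ℕ.+-suc m n) ⟨
    - fromℕ (suc m ℕ.+ suc n)            ≈⟨ -‿cong (×-homo-+ 1# (suc m) (suc n)) ⟩
    - (fromℕ (suc m) + fromℕ (suc n))    ≈⟨ ⁻¹-∙-comm _ _ ⟨
    - fromℕ (suc m) + - fromℕ (suc n)    ∎

  -‿homo : ∀ i → ⟦ ℤ.- i ⟧ ≈ - ⟦ i ⟧
  -‿homo ℤ.-[1+ n ] = sym (⁻¹-involutive _)
  -‿homo ℤ.+0       = sym ε⁻¹≈ε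
  -‿homo ℤ.+[1+ n ] = refl

  *-homo : ∀ i j → ⟦ i ℤ.* j ⟧ ≈ ⟦ i ⟧ * ⟦ j ⟧
  *-homo i j = begin
    ⟦ ℤ.sign i Sign.* ℤ.sign j ℤ.◃ ℤ.∣ i ∣ ℕ.* ℤ.∣ j ∣ ⟧
      ≈⟨ ◃-homo (ℤ.sign i Sign.* ℤ.sign j) (ℤ.∣ i ∣ ℕ.* ℤ.∣ j ∣) ⟩
    ⟦ ℤ.sign i Sign.* ℤ.sign j ⟧ₛ * fromℕ (ℤ.∣ i ∣ ℕ.* ℤ.∣ j ∣)
      ≈⟨ *-cong (sign-*-homo (ℤ.sign i) (ℤ.sign j)) (×1-homo-* ℤ.∣ i ∣ ℤ.∣ j ∣) ⟩
    (⟦ ℤ.sign i ⟧ₛ * ⟦ ℤ.sign j ⟧ₛ) * (fromℕ ℤ.∣ i ∣ * fromℕ ℤ.∣ j ∣)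
      ≈⟨ *-interchange _ _ _ _ ⟩
    (⟦ ℤ.sign i ⟧ₛ * fromℕ ℤ.∣ i ∣) * (⟦ ℤ.sign j ⟧ₛ * fromℕ ℤ.∣ j ∣)
      ≈⟨ *-cong (sign-abs i) (sign-abs j) ⟨
    ⟦ i ⟧ * ⟦ j ⟧
      ∎

  homomorphism : ℤ.+-*-rawRing ACR.-Raw-AlmostCommutative⟶ ACR.fromCommutativeRing R
  homomorphism = record
    { ⟦_⟧    = ⟦_⟧
    ; +-homo = +-homo
    ; *-homo = *-homo
    ; -‿homo = -‿homo
    ; 0-homo = refl
    ; 1-homo = refl
    }

  ⟦⟧-equal? : ∀ i j → Maybe (⟦ i ⟧ ≈ ⟦ j ⟧)
  ⟦⟧-equal? i j with i ℤ.≟ j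
  ... | yes ≡.refl = just refl
  ... | no _       = nothing

  open Algebra.Solver.Ring ℤ.+-*-rawRing (ACR.fromCommutativeRing R) homomorphism ⟦⟧-equal?
    public using (solve; Polynomial; _:+_; _:*_; :-_; _:-_; con; _:=_)

module Counting {A : Set} {n : ℕ} (enum : Fin n ↔ A) where
  open import Data.Nat.Base using (_+_)
  open ≡ using (refl; sym; trans; cong; subst)

  private
    variable
      P Q C : Pred A 0ℓ

    elt : Fin n → A
    elt = Inverse.to enum

  position : A → Fin n
  position = Inverse.from enum

  index : A → ℕ
  index = toℕ ∘ position

  elt-injective : ∀ {i j} → elt i ≡ elt j → i ≡ j
  elt-injective {i} {j} e = begin
    i                   ≡⟨ Inverse.strictlyInverseʳ enum i ⟨
    position (elt i)    ≡⟨ cong position e ⟩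
    position (elt j)    ≡⟨ Inverse.strictlyInverseʳ enum j ⟩
    j                   ∎
    where open ≡.≡-Reasoning

  position-injective : ∀ {x y} → position x ≡ position y → x ≡ y
  position-injective {x} {y} e = begin
    x                   ≡⟨ Inverse.strictlyInverseˡ enum x ⟨
    elt (position x)    ≡⟨ cong elt e ⟩
    elt (position y)    ≡⟨ Inverse.strictlyInverseˡ enum y ⟩
    y                   ∎
    where open ≡.≡-Reasoning

  index-injective : ∀ {x y} → index x ≡ index y → x ≡ y
  index-injective = position-injective ∘ Fin.toℕ-injective

  via-position : ∀ {x} → P x → P (elt (position x))
  via-position {P} {x} = subst P (sym (Inverse.strictlyInverseˡ enum x))

  count : {P : Pred A 0ℓ} → Decidable P → ℕ
  count P? = length (filter (P? ∘ elt) (allFin n))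

  count-U : count U? ≡ n
  count-U = trans (cong length (filter-all (U? ∘ elt) (All.universal _ (allFin n))))
                  (length-tabulate (λ i → i))

  count-zero : (P? : Decidable P) → (∀ x → ¬ P x) → count P? ≡ 0
  count-zero P? none = cong length (filter-none (P? ∘ elt) (All.universal (none ∘ elt) (allFin n)))

  count-pos : (P? : Decidable P) → ∀ {x} → P x → 0 < count P?
  count-pos {P} P? {x} px = filter-some (P? ∘ elt) {xs = allFin n}
    (Any.map (λ { refl → via-position {P} px }) (∈-allFin (position x)))

  count-mono : (P? : Decidable P) (Q? : Decidable Q) → P ⊆ Q → count P? ≤ count Q?
  count-mono P? Q? P⊆Q =
    length-mono-≤ (filter⁺ (P? ∘ elt) (Q? ∘ elt) (λ { refl → P⊆Q }) (⊆-refl {x = allFin n}))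

  count-cong : (P? : Decidable P) (Q? : Decidable Q) → P ⊆ Q → Q ⊆ P → count P? ≡ count Q?
  count-cong P? Q? P⊆Q Q⊆P = ℕ.≤-antisym (count-mono P? Q? P⊆Q) (count-mono Q? P? Q⊆P)

  count-partition : (P? : Decidable P) (C? : Decidable C) →
                    count P? ≡ count (P? ∩? C?) + count (P? ∩? ∁? C?)
  count-partition P? C? = go (allFin n)
    where
    go : ∀ is → length (filter (P? ∘ elt) is)
              ≡ length (filter ((P? ∩? C?) ∘ elt) is) + length (filter ((P? ∩? ∁? C?) ∘ elt) is)
    go [] = refl
    go (i ∷ is) with P? (elt i) | C? (elt i)
    ... | yes _ | yes _ = cong suc (go is)
    ... | yes _ | no _  = trans (cong suc (go is)) (sym (ℕ.+-suc _ _))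
    ... | no _  | yes _ = go is
    ... | no _  | no _  = go is

  count-∪ : (P? : Decidable P) (Q? : Decidable Q) → count (P? ∪? Q?) ≤ count P? + count Q?
  count-∪ {P} {Q} P? Q? = begin
    count (P? ∪? Q?)                                         ≡⟨ count-partition (P? ∪? Q?) P? ⟩
    count ((P? ∪? Q?) ∩? P?) + count ((P? ∪? Q?) ∩? ∁? P?)
      ≤⟨ ℕ.+-mono-≤ (count-mono ((P? ∪? Q?) ∩? P?) P? proj₂) (count-mono ((P? ∪? Q?) ∩? ∁? P?) Q? onlyQ) ⟩
    count P? + count Q?                                      ∎
    where
    open ℕ.≤-Reasoning
    onlyQ : (P ∪ Q) ∩ ∁ P ⊆ Q
    onlyQ (inj₁ p , ¬p) = contradiction p ¬p
    onlyQ (inj₂ q , _)  = q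

  count-< : (P? : Decidable P) (Q? : Decidable Q) → P ⊆ Q → ∀ {y} → Q y → ¬ P y → count P? < count Q?
  count-< {P} {Q} P? Q? P⊆Q qy ¬py = begin-strict
    count P?                                 ≡⟨ ℕ.+-identityʳ _ ⟨
    count P? + 0                             <⟨ ℕ.+-monoʳ-< (count P?) (count-pos (Q? ∩? ∁? P?) (qy , ¬py)) ⟩
    count P? + count (Q? ∩? ∁? P?)           ≤⟨ ℕ.+-monoˡ-≤ _ (count-mono P? (Q? ∩? P?) (λ p → P⊆Q p , p)) ⟩
    count (Q? ∩? P?) + count (Q? ∩? ∁? P?)   ≡⟨ count-partition Q? P? ⟨
    count Q?                                 ∎
    where open ℕ.≤-Reasoning

  count-≤1 : (P? : Decidable P) → (∀ {x y} → P x → P y → x ≡ y) → count P? ≤ 1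
  count-≤1 {P} P? unique = go (filter (P? ∘ elt) (allFin n))
                              (Unique.filter⁺ (P? ∘ elt) (Unique.allFin⁺ n))
                              (all-filter (P? ∘ elt) (allFin n))
    where
    go : ∀ is → Unique is → All (P ∘ elt) is → length is ≤ 1
    go []          _               _             = z≤n
    go (_ ∷ [])    _               _             = s≤s z≤n
    go (_ ∷ _ ∷ _) ((i≢j ∷ _) ∷ _) (pi ∷ pj ∷ _) = contradiction (elt-injective (unique pi pj)) i≢j

  count-≤-if-inhabited : ∀ {k} (P? : Decidable P) → (∀ {x} → P x → count P? ≤ k) → count P? ≤ k
  count-≤-if-inhabited {P} P? bound with Fin.any? (P? ∘ elt)
  ... | yes (_ , p) = bound p
  ... | no none     =
    ℕ.≤-trans (ℕ.≤-reflexive (count-zero P? (λ x p → none (position x , via-position {P} p)))) z≤n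

  private
    lookup-injective : ∀ {B : Set} {xs : List B} → Unique xs → ∀ {k l} → lookup xs k ≡ lookup xs l → k ≡ l
    lookup-injective {xs = _ ∷ _} _          {Fin.zero}  {Fin.zero}  _ = refl
    lookup-injective {xs = _ ∷ _} (x∉ ∷ _)   {Fin.zero}  {Fin.suc l} e = contradiction e (All.lookup x∉ (∈-lookup l))
    lookup-injective {xs = _ ∷ _} (x∉ ∷ _)   {Fin.suc k} {Fin.zero}  e =
      contradiction (sym e) (All.lookup x∉ (∈-lookup k))
    lookup-injective {xs = _ ∷ _} (_ ∷ uniq) {Fin.suc k} {Fin.suc l} e = cong Fin.suc (lookup-injective uniq e)

  count-≤-injection : (P? : Decidable P) (Q? : Decidable Q) (f : A → A) →
                      (∀ {x} → P x → Q (f x)) → (∀ {x y} → P x → P y → f x ≡ f y → x ≡ y) →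
                      count P? ≤ count Q?
  count-≤-injection {P} {Q} P? Q? f maps-to injective = Fin.injective⇒≤ g-injective
    where
    ps qs : List (Fin n)
    ps = filter (P? ∘ elt) (allFin n)
    qs = filter (Q? ∘ elt) (allFin n)

    member : Fin (length ps) → A
    member k = elt (lookup ps k)

    member-P : ∀ k → P (member k)
    member-P k = proj₂ (∈-filter⁻ (P? ∘ elt) {xs = allFin n} (∈-lookup k))

    image∈qs : ∀ k → position (f (member k)) ∈ qs
    image∈qs k = ∈-filter⁺ (Q? ∘ elt) (∈-allFin _) (via-position {Q} (maps-to (member-P k)))

    g : Fin (length ps) → Fin (length qs)
    g k = Any.index (image∈qs k)

    g-injective : ∀ {k l} → g k ≡ g l → k ≡ l
    g-injective {k} {l} e = lookup-injective (Unique.filter⁺ (P? ∘ elt) (Unique.allFin⁺ n))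
      (elt-injective (injective (member-P k) (member-P l) (position-injective (begin
        position (f (member k))  ≡⟨ lookup-index (image∈qs k) ⟩
        lookup qs (g k)          ≡⟨ cong (lookup qs) e ⟩
        lookup qs (g l)          ≡⟨ lookup-index (image∈qs l) ⟨
        position (f (member l))  ∎))))
      where open ≡.≡-Reasoning

  -- For a fixed-point-free involution f, LowerHalf f contains exactly one point of
  -- each orbit {x, f x}.
  LowerHalf : (A → A) → Pred A 0ℓ
  LowerHalf f x = index x < index (f x)

  lowerHalf? : (f : A → A) → Decidable (LowerHalf f)
  lowerHalf? f x = index x ℕ.<? index (f x)

  module _ {f : A → A} (involutive : ∀ x → f (f x) ≡ x) where

    ¬LowerHalf-image : ∀ {x} → LowerHalf f x → ¬ LowerHalf f (f x)
    ¬LowerHalf-image {x} x<fx fx<ffx =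
      ℕ.<-asym x<fx (subst (λ z → index (f x) < index z) (involutive x) fx<ffx)

    LowerHalf-image : ∀ {x} → f x ≢ x → ¬ LowerHalf f x → LowerHalf f (f x)
    LowerHalf-image {x} fx≢x x≮fx = subst (λ z → index (f x) < index z) (sym (involutive x))
      (ℕ.≤∧≢⇒< (ℕ.≮⇒≥ x≮fx) (λ e → fx≢x (index-injective e)))

    count-involution : (P? : Decidable P) → (∀ {x} → P x → P (f x)) → (∀ {x} → P x → f x ≢ x) →
                       count P? ≡ count (P? ∩? lowerHalf? f) + count (P? ∩? lowerHalf? f)
    count-involution P? preserves no-fixed-point =
      trans (count-partition P? (lowerHalf? f)) (cong (count (P? ∩? lowerHalf? f) +_) (sym halves))
      where
      f-injective : ∀ {x y} → f x ≡ f y → x ≡ y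
      f-injective {x} {y} e = trans (sym (involutive x)) (trans (cong f e) (involutive y))

      halves : count (P? ∩? lowerHalf? f) ≡ count (P? ∩? ∁? (lowerHalf? f))
      halves = ℕ.≤-antisym
        (count-≤-injection (P? ∩? lowerHalf? f) (P? ∩? ∁? (lowerHalf? f)) f
          (λ (p , low) → preserves p , ¬LowerHalf-image low) (λ _ _ → f-injective))
        (count-≤-injection (P? ∩? ∁? (lowerHalf? f)) (P? ∩? lowerHalf? f) f
          (λ (p , ¬low) → preserves p , LowerHalf-image (no-fixed-point p) ¬low) (λ _ _ → f-injective))

module ResidueThreeModFour {m : ℕ} (m%4≡3 : m % 4 ≡ 3) where
  open import Data.Nat.Base using (_+_; _*_; _/_)
  open ≡ using (cong; trans)
  open ≡.≡-Reasoning

  private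
    k+k≡k*2 : ∀ k → k + k ≡ k * 2
    k+k≡k*2 = solve-∀

    1+4k≡1+k*4 : ∀ k → suc ((k + k) + (k + k)) ≡ 1 + k * 4
    1+4k≡1+k*4 = solve-∀

  m%2≡1 : m % 2 ≡ 1
  m%2≡1 = begin
    m % 2                      ≡⟨ cong (_% 2) (ℕ.m≡m%n+[m/n]*n m 4) ⟩
    (m % 4 + m / 4 * 4) % 2    ≡⟨ cong (λ r → (r + m / 4 * 4) % 2) m%4≡3 ⟩
    (3 + m / 4 * 4) % 2        ≡⟨ cong (λ t → (3 + t) % 2) (ℕ.*-assoc (m / 4) 2 2) ⟨
    (3 + m / 4 * 2 * 2) % 2    ≡⟨ ℕ.[m+kn]%n≡m%n 3 (m / 4 * 2) 2 ⟩
    1                          ∎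

  m≢k+k : ∀ k → m ≢ k + k
  m≢k+k k m≡k+k with () ← begin
    1                ≡⟨ m%2≡1 ⟨
    m % 2            ≡⟨ cong (_% 2) (trans m≡k+k (k+k≡k*2 k)) ⟩
    (k * 2) % 2      ≡⟨ ℕ.m*n%n≡0 k 2 ⟩
    0                ∎

  m≢1+4k : ∀ k → m ≢ suc ((k + k) + (k + k))
  m≢1+4k k m≡1+4k with () ← begin
    3                      ≡⟨ m%4≡3 ⟨
    m % 4                  ≡⟨ cong (_% 4) (trans m≡1+4k (1+4k≡1+k*4 k)) ⟩
    (1 + k * 4) % 4        ≡⟨ ℕ.[m+kn]%n≡m%n 1 k 4 ⟩
    1                      ∎

module FiniteFieldFacts {q : ℕ} (𝔽 : FiniteField q) where
  open FiniteField 𝔽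
  open ≡ using (refl; sym; trans; cong; cong₂; subst)

  commutativeRing : CommutativeRing 0ℓ 0ℓ
  commutativeRing = record { isCommutativeRing = isCommutativeRing }

  open CommutativeRing commutativeRing using (+-comm; +-identityʳ; *-comm; *-identityˡ; zeroˡ; -‿inverseˡ; +-group; ring)
  open import Algebra.Properties.Ring ring using (-1*x≈-x)
  open import Algebra.Properties.Group +-group
    using (x∙y⁻¹≈ε⇒x≈y; x≈y⇒x∙y⁻¹≈ε; ⁻¹-involutive; ⁻¹-injective; ε⁻¹≈ε)
  open IntegerCoefficientSolver commutativeRing
  open Counting enum
  open ≡.≡-Reasoning

  :0 :1 :2 : ∀ {k} → Polynomial k
  :0 = con (ℤ.+ 0)
  :1 = con (ℤ.+ 1)
  :2 = con (ℤ.+ 2)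

  1≢0 : 1# ≢ 0#
  1≢0 1≡0 = 0≢1 (sym 1≡0)

  x-y≡0⇒x≡y : ∀ {x y} → x - y ≡ 0# → x ≡ y
  x-y≡0⇒x≡y = x∙y⁻¹≈ε⇒x≈y _ _

  x+y≡0⇒x≡-y : ∀ {x y} → x + y ≡ 0# → x ≡ - y
  x+y≡0⇒x≡-y {x} {y} x+y≡0 = x-y≡0⇒x≡y (trans (cong (x +_) (⁻¹-involutive y)) x+y≡0)

  -x≢0 : ∀ {x} → x ≢ 0# → - x ≢ 0#
  -x≢0 x≢0 -x≡0 = x≢0 (⁻¹-injective (trans -x≡0 (sym ε⁻¹≈ε)))

  x*y≡0⇒x≡0⊎y≡0 : ∀ {x y} → x * y ≡ 0# → x ≡ 0# ⊎ y ≡ 0#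
  x*y≡0⇒x≡0⊎y≡0 {x} {y} xy≡0 with x ≟ 0#
  ... | yes x≡0 = inj₁ x≡0
  ... | no x≢0 with z , xz≡1 ← inverse x x≢0 = inj₂ (begin
    y                              ≡⟨ solve 3 (λ x y z → y := z :* (x :* y) :+ (:1 :- x :* z) :* y) refl x y z ⟩
    z * (x * y) + (1# - x * z) * y ≡⟨ cong₂ (λ a b → z * a + (1# - b) * y) xy≡0 xz≡1 ⟩
    z * 0# + (1# - 1#) * y         ≡⟨ solve 2 (λ z y → z :* :0 :+ (:1 :- :1) :* y := :0) refl z y ⟩
    0#                             ∎)

  x*y≢0 : ∀ {x y} → x ≢ 0# → y ≢ 0# → x * y ≢ 0#
  x*y≢0 x≢0 y≢0 xy≡0 with x*y≡0⇒x≡0⊎y≡0 xy≡0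
  ... | inj₁ x≡0 = x≢0 x≡0
  ... | inj₂ y≡0 = y≢0 y≡0

  x≢0∧x*y≡0⇒y≡0 : ∀ {x y} → x ≢ 0# → x * y ≡ 0# → y ≡ 0#
  x≢0∧x*y≡0⇒y≡0 x≢0 xy≡0 with x*y≡0⇒x≡0⊎y≡0 xy≡0
  ... | inj₁ x≡0 = contradiction x≡0 x≢0
  ... | inj₂ y≡0 = y≡0

  *-cancelˡ-≡ : ∀ {a x y} → a ≢ 0# → a * x ≡ a * y → x ≡ y
  *-cancelˡ-≡ {a} {x} {y} a≢0 ax≡ay = x-y≡0⇒x≡y (x≢0∧x*y≡0⇒y≡0 a≢0 (begin
    a * (x - y)    ≡⟨ solve 3 (λ a x y → a :* (x :- y) := a :* x :- a :* y) refl a x y ⟩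
    a * x - a * y  ≡⟨ x≈y⇒x∙y⁻¹≈ε ax≡ay ⟩
    0#             ∎))

  x*x≡y*y⇒x≡y⊎x≡-y : ∀ {x y} → x * x ≡ y * y → x ≡ y ⊎ x ≡ - y
  x*x≡y*y⇒x≡y⊎x≡-y {x} {y} xx≡yy with x*y≡0⇒x≡0⊎y≡0 (begin
    (x - y) * (x + y)  ≡⟨ solve 2 (λ x y → (x :- y) :* (x :+ y) := x :* x :- y :* y) refl x y ⟩
    x * x - y * y      ≡⟨ x≈y⇒x∙y⁻¹≈ε xx≡yy ⟩
    0#                 ∎)
  ... | inj₁ x-y≡0 = inj₁ (x-y≡0⇒x≡y x-y≡0)
  ... | inj₂ x+y≡0 = inj₂ (x+y≡0⇒x≡-y x+y≡0)

  Linear : Carrier → Carrier → Pred Carrier 0ℓ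
  Linear α β x = α * x + β ≡ 0#

  linear? : ∀ α β → Decidable (Linear α β)
  linear? α β x = (α * x + β) ≟ 0#

  Quadratic : Carrier → Carrier → Carrier → Pred Carrier 0ℓ
  Quadratic a b c x = a * x * x + b * x + c ≡ 0#

  quadratic? : ∀ a b c → Decidable (Quadratic a b c)
  quadratic? a b c x = (a * x * x + b * x + c) ≟ 0#

  linear-root-unique : ∀ {α β x y} → α ≢ 0# → Linear α β x → Linear α β y → x ≡ y
  linear-root-unique {α} {β} {x} {y} α≢0 αx+β≡0 αy+β≡0 = *-cancelˡ-≡ α≢0 (x-y≡0⇒x≡y (begin
    α * x - α * y               ≡⟨ solve 4 (λ α β x y → α :* x :- α :* y := (α :* x :+ β) :- (α :* y :+ β))
                                           refl α β x y ⟩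
    (α * x + β) - (α * y + β)   ≡⟨ x≈y⇒x∙y⁻¹≈ε (trans αx+β≡0 (sym αy+β≡0)) ⟩
    0#                          ∎))

  quadratic-other-root : ∀ {a b c r x} → Quadratic a b c r → Quadratic a b c x →
                         x ≡ r ⊎ Linear a (a * r + b) x
  quadratic-other-root {a} {b} {c} {r} {x} Qr Qx with x*y≡0⇒x≡0⊎y≡0 (begin
    (x - r) * (a * x + (a * r + b))
      ≡⟨ solve 5 (λ a b c r x → (x :- r) :* (a :* x :+ (a :* r :+ b))
                              := (a :* x :* x :+ b :* x :+ c) :- (a :* r :* r :+ b :* r :+ c)) refl a b c r x ⟩
    (a * x * x + b * x + c) - (a * r * r + b * r + c)
      ≡⟨ x≈y⇒x∙y⁻¹≈ε (trans Qx (sym Qr)) ⟩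
    0# ∎)
  ... | inj₁ x-r≡0 = inj₁ (x-y≡0⇒x≡y x-r≡0)
  ... | inj₂ Lx    = inj₂ Lx

  count-linear-roots : ∀ {α} β → α ≢ 0# → count (linear? α β) ≤ 1
  count-linear-roots β α≢0 = count-≤1 (linear? _ β) (linear-root-unique α≢0)

  count-≡ : ∀ w → count (_≟ w) ≤ 1
  count-≡ w = count-≤1 (_≟ w) (λ x≡w y≡w → trans x≡w (sym y≡w))

  count-quadratic-roots : ∀ {a} b c → a ≢ 0# → count (quadratic? a b c) ≤ 2
  count-quadratic-roots {a} b c a≢0 = count-≤-if-inhabited (quadratic? a b c) λ {r} Qr →
    ℕ.≤-trans (count-mono (quadratic? a b c) ((_≟ r) ∪? linear? a (a * r + b)) (quadratic-other-root Qr))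
   (ℕ.≤-trans (count-∪ (_≟ r) (linear? a (a * r + b)))
              (ℕ.+-mono-≤ (count-≡ r) (count-linear-roots (a * r + b) a≢0)))

  count-≤1+1+2 : ∀ {P} (P? : Decidable P) w {α β a b c} → α ≢ 0# → a ≢ 0# →
                 (∀ {x} → P x → x ≡ w ⊎ Linear α β x ⊎ Quadratic a b c x) → count P? ≤ 4
  count-≤1+1+2 P? w {α} {β} {a} {b} {c} α≢0 a≢0 cover =
    ℕ.≤-trans (count-mono P? ((_≟ w) ∪? (linear? α β ∪? quadratic? a b c)) cover)
   (ℕ.≤-trans (count-∪ (_≟ w) (linear? α β ∪? quadratic? a b c))
              (ℕ.+-mono-≤ (count-≡ w)
              (ℕ.≤-trans (count-∪ (linear? α β) (quadratic? a b c))
                         (ℕ.+-mono-≤ (count-linear-roots β α≢0) (count-quadratic-roots b c a≢0)))))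

  count-≤4 : ∀ {P} (P? : Decidable P) {C : Set} → Dec C → ∀ w {α β α′ β′ a b c} →
             α ≢ 0# → α′ ≢ 0# → a ≢ 0# →
             (∀ {x} → P x → x ≡ w ⊎ (¬ C × Linear α β x) ⊎ (C × Linear α′ β′ x) ⊎ Quadratic a b c x) →
             count P? ≤ 4
  count-≤4 P? (yes c) w _ α′≢0 a≢0 cover = count-≤1+1+2 P? w α′≢0 a≢0 λ Px → case cover Px of λ where
    (inj₁ x≡w)                   → inj₁ x≡w
    (inj₂ (inj₁ (¬c , _)))       → contradiction c ¬c
    (inj₂ (inj₂ (inj₁ (_ , L)))) → inj₂ (inj₁ L)
    (inj₂ (inj₂ (inj₂ Q)))       → inj₂ (inj₂ Q)
  count-≤4 P? (no ¬c) w α≢0 _ a≢0 cover = count-≤1+1+2 P? w α≢0 a≢0 λ Px → case cover Px of λ where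
    (inj₁ x≡w)                   → inj₁ x≡w
    (inj₂ (inj₁ (_ , L)))        → inj₂ (inj₁ L)
    (inj₂ (inj₂ (inj₁ (c , _)))) → contradiction c ¬c
    (inj₂ (inj₂ (inj₂ Q)))       → inj₂ (inj₂ Q)

  Square : Pred Carrier 0ℓ
  Square x = ∃ λ y → y * y ≡ x

  square? : Decidable Square
  square? x with Fin.any? (λ i → (elt i * elt i) ≟ x)
  ... | yes (i , ii≡x) = yes (elt i , ii≡x)
  ... | no ∄           = no λ (y , yy≡x) → ∄ (position y , via-position {λ z → z * z ≡ x} yy≡x)

  root≢0 : ∀ {y s} → y * y ≡ s → s ≢ 0# → y ≢ 0#
  root≢0 {y} yy≡s s≢0 y≡0 = s≢0 (trans (sym yy≡s) (trans (cong (λ z → z * z) y≡0) (zeroˡ 0#)))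

  1-square : Square 1#
  1-square = 1# , *-identityˡ 1#

  square-*-square : ∀ {a b} → Square a → Square b → Square (a * b)
  square-*-square {a} {b} (r , rr≡a) (t , tt≡b) = r * t , (begin
    (r * t) * (r * t)  ≡⟨ solve 2 (λ r t → (r :* t) :* (r :* t) := (r :* r) :* (t :* t)) refl r t ⟩
    (r * r) * (t * t)  ≡⟨ cong₂ _*_ rr≡a tt≡b ⟩
    a * b              ∎)

  square-*-nonsquare : ∀ {a b} → a ≢ 0# → Square a → ¬ Square b → ¬ Square (a * b)
  square-*-nonsquare {a} {b} a≢0 (r , rr≡a) ¬□b (t , tt≡ab) with r′ , rr′≡1 ← inverse r (root≢0 rr≡a a≢0) =
    ¬□b (t * r′ , (begin
      (t * r′) * (t * r′)        ≡⟨ solve 2 (λ t r′ → (t :* r′) :* (t :* r′) := (t :* t) :* (r′ :* r′)) refl t r′ ⟩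
      (t * t) * (r′ * r′)        ≡⟨ cong (λ z → z * (r′ * r′)) (trans tt≡ab (cong (_* b) (sym rr≡a))) ⟩
      ((r * r) * b) * (r′ * r′)  ≡⟨ solve 3 (λ r b r′ → ((r :* r) :* b) :* (r′ :* r′) := b :* ((r :* r′) :* (r :* r′)))
                                          refl r b r′ ⟩
      b * ((r * r′) * (r * r′))  ≡⟨ cong (λ z → b * (z * z)) rr′≡1 ⟩
      b * (1# * 1#)              ≡⟨ solve 1 (λ b → b :* (:1 :* :1) := b) refl b ⟩
      b                          ∎))

  nonzero? : Decidable (∁ (_≡ 0#))
  nonzero? = ∁? (_≟ 0#)

  NonzeroSquare Nonsquare : Pred Carrier 0ℓ
  NonzeroSquare = ∁ (_≡ 0#) ∩ Square
  Nonsquare     = ∁ (_≡ 0#) ∩ ∁ Square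

  nonzeroSquare? : Decidable NonzeroSquare
  nonzeroSquare? = nonzero? ∩? square?

  nonsquare? : Decidable Nonsquare
  nonsquare? = nonzero? ∩? ∁? square?

  Half : Pred Carrier 0ℓ
  Half = ∁ (_≡ 0#) ∩ LowerHalf (-_)

  half? : Decidable Half
  half? = nonzero? ∩? lowerHalf? (-_)

  count-nonzero : q ≡ suc (count nonzero?)
  count-nonzero = begin
    q                                                    ≡⟨ count-U ⟨
    count U?                                             ≡⟨ count-partition U? (_≟ 0#) ⟩
    count (U? ∩? (_≟ 0#)) ℕ.+ count (U? ∩? ∁? (_≟ 0#))   ≡⟨ cong₂ ℕ._+_ zero-once nonzero-rest ⟩
    1 ℕ.+ count nonzero?                                 ∎
    where
    zero-once : count (U? ∩? (_≟ 0#)) ≡ 1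
    zero-once = ℕ.≤-antisym (ℕ.≤-trans (count-mono (U? ∩? (_≟ 0#)) (_≟ 0#) proj₂) (count-≡ 0#))
                            (count-pos (U? ∩? (_≟ 0#)) (tt , refl))
    nonzero-rest : count (U? ∩? ∁? (_≟ 0#)) ≡ count nonzero?
    nonzero-rest = count-cong (U? ∩? ∁? (_≟ 0#)) nonzero? proj₂ (tt ,_)

  private
    squares-to : Carrier → Fin q → Bool
    squares-to x i = does ((elt i * elt i) ≟ x)

  isSquare-sound : ∀ {x} → T (isSquare x) → Square x
  isSquare-sound {x} t with i , root ← Any.satisfied (any⁻ (squares-to x) (allFin q) t) =
    elt i , decidable-stable ii≟x (λ ii≢x → subst T (dec-false ii≟x ii≢x) root)
    where ii≟x = (elt i * elt i) ≟ x

  isSquare-complete : ∀ {x} → Square x → T (isSquare x)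
  isSquare-complete {x} (y , yy≡x) = any⁺ (squares-to x)
    (Any.map (λ { refl → root-at (position y) (via-position {λ z → z * z ≡ x} yy≡x) }) (∈-allFin (position y)))
    where
    root-at : ∀ i → elt i * elt i ≡ x → T (squares-to x i)
    root-at i ii≡x = subst T (sym (dec-true ((elt i * elt i) ≟ x) ii≡x)) tt

  data Character (x v : Carrier) : Set where
    zero      : x ≡ 0# → Character x v
    square    : x ≢ 0# → Square x → v ≡ 1# → Character x v
    nonsquare : x ≢ 0# → ¬ Square x → v ≡ - 1# → Character x v

  character : ∀ x → Character x (η x)
  character x with x ≟ 0#
  ... | yes x≡0 = zero x≡0
  ... | no x≢0 with isSquare x in isSq
  ...   | true  = square x≢0 (isSquare-sound (subst T (sym isSq) tt)) refl
  ...   | false = nonsquare x≢0 (λ □x → subst T isSq (isSquare-complete □x)) refl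

  η1≡1 : η 1# ≡ 1#
  η1≡1 with character 1#
  ... | zero 1≡0          = contradiction 1≡0 1≢0
  ... | square _ _ η1     = η1
  ... | nonsquare _ ¬□1 _ = contradiction 1-square ¬□1

  F₂[0]≡0 : ∀ u → F₂ u 0# ≡ 0#
  F₂[0]≡0 u = solve 2 (λ u t → :0 :* :0 :* (:1 :+ u :* t) := :0) refl u (η 0#)

  module _ (q%4≡3 : q % 4 ≡ 3) where
    open ResidueThreeModFour {q} q%4≡3

    -- In characteristic 2, x ↦ x + 1 would be a fixed-point-free involution of the
    -- whole field, making q even.
    2≢0 : 1# + 1# ≢ 0#
    2≢0 2≡0 = m≢k+k (count (U? ∩? lowerHalf? (_+ 1#)))
      (trans (sym count-U) (count-involution x+1+1≡x U? (λ _ → tt) (λ _ → x+1≢x)))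
      where
      x+1+1≡x : ∀ x → x + 1# + 1# ≡ x
      x+1+1≡x x = begin
        x + 1# + 1#   ≡⟨ solve 1 (λ x → x :+ :1 :+ :1 := x :+ (:1 :+ :1)) refl x ⟩
        x + (1# + 1#) ≡⟨ cong (x +_) 2≡0 ⟩
        x + 0#        ≡⟨ +-identityʳ x ⟩
        x             ∎
      x+1≢x : ∀ {x} → x + 1# ≢ x
      x+1≢x {x} x+1≡x = 1≢0 (begin
        1#             ≡⟨ solve 1 (λ x → :1 := (x :+ :1) :- x) refl x ⟩
        (x + 1#) - x   ≡⟨ x≈y⇒x∙y⁻¹≈ε x+1≡x ⟩
        0#             ∎)

    -x≢x : ∀ {x} → x ≢ 0# → - x ≢ x
    -x≢x {x} x≢0 -x≡x = x≢0 (x≢0∧x*y≡0⇒y≡0 2≢0 (begin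
      (1# + 1#) * x  ≡⟨ solve 1 (λ x → (:1 :+ :1) :* x := x :- (:- x)) refl x ⟩
      x - (- x)      ≡⟨ x≈y⇒x∙y⁻¹≈ε (sym -x≡x) ⟩
      0#             ∎))

    count-nonzero-halves : count nonzero? ≡ count half? ℕ.+ count half?
    count-nonzero-halves = count-involution {f = -_} ⁻¹-involutive nonzero? -x≢0 -x≢x

    -- Junk value s when s is not a square.
    lowerRoot : Carrier → Carrier
    lowerRoot s with square? s
    ... | no _ = s
    ... | yes (y , _) with lowerHalf? (-_) y
    ...   | yes _ = y
    ...   | no _  = - y

    lowerRoot-spec : ∀ {s} → NonzeroSquare s → lowerRoot s * lowerRoot s ≡ s × Half (lowerRoot s)
    lowerRoot-spec {s} (s≢0 , □s) with square? s
    ... | no ¬□s = contradiction □s ¬□s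
    ... | yes (y , yy≡s) with lowerHalf? (-_) y
    ...   | yes low = yy≡s , root≢0 yy≡s s≢0 , low
    ...   | no ¬low = trans (solve 1 (λ y → (:- y) :* (:- y) := y :* y) refl y) yy≡s
                    , -x≢0 (root≢0 yy≡s s≢0)
                    , LowerHalf-image {f = -_} ⁻¹-involutive (-x≢x (root≢0 yy≡s s≢0)) ¬low

    count-nonzeroSquare≡count-half : count nonzeroSquare? ≡ count half?
    count-nonzeroSquare≡count-half = ℕ.≤-antisym
      (count-≤-injection nonzeroSquare? half? lowerRoot (proj₂ ∘ lowerRoot-spec) root-injective)
      (count-≤-injection half? nonzeroSquare? (λ x → x * x) (λ (x≢0 , _) → x*y≢0 x≢0 x≢0 , (_ , refl))
                         squaring-injective)
      where
      root-injective : ∀ {s t} → NonzeroSquare s → NonzeroSquare t → lowerRoot s ≡ lowerRoot t → s ≡ t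
      root-injective {s} {t} □s □t e = begin
        s                            ≡⟨ proj₁ (lowerRoot-spec □s) ⟨
        lowerRoot s * lowerRoot s    ≡⟨ cong (λ z → z * z) e ⟩
        lowerRoot t * lowerRoot t    ≡⟨ proj₁ (lowerRoot-spec □t) ⟩
        t                            ∎

      squaring-injective : ∀ {x y} → Half x → Half y → x * x ≡ y * y → x ≡ y
      squaring-injective (_ , low-x) (_ , low-y) xx≡yy with x*x≡y*y⇒x≡y⊎x≡-y xx≡yy
      ... | inj₁ x≡y  = x≡y
      ... | inj₂ x≡-y =
        contradiction (subst (LowerHalf (-_)) x≡-y low-x) (¬LowerHalf-image {f = -_} ⁻¹-involutive low-y)

    count-nonsquare≡count-nonzeroSquare : count nonsquare? ≡ count nonzeroSquare?
    count-nonsquare≡count-nonzeroSquare = ℕ.+-cancelˡ-≡ (count nonzeroSquare?) _ _ (begin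
      count nonzeroSquare? ℕ.+ count nonsquare?        ≡⟨ count-partition nonzero? square? ⟨
      count nonzero?                                   ≡⟨ count-nonzero-halves ⟩
      count half? ℕ.+ count half?                      ≡⟨ cong₂ ℕ._+_ count-nonzeroSquare≡count-half
                                                                      count-nonzeroSquare≡count-half ⟨
      count nonzeroSquare? ℕ.+ count nonzeroSquare?    ∎)

    q≡1+2·count-nonzeroSquare : q ≡ suc (count nonzeroSquare? ℕ.+ count nonzeroSquare?)
    q≡1+2·count-nonzeroSquare = begin
      q                                                     ≡⟨ count-nonzero ⟩
      suc (count nonzero?)                                  ≡⟨ cong suc (count-partition nonzero? square?) ⟩
      suc (count nonzeroSquare? ℕ.+ count nonsquare?)       ≡⟨ cong (λ k → suc (count nonzeroSquare? ℕ.+ k))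
                                                                     count-nonsquare≡count-nonzeroSquare ⟩
      suc (count nonzeroSquare? ℕ.+ count nonzeroSquare?)   ∎

    -- Negation would pair up the nonzero squares, giving q ≡ 1 (mod 4).
    -1-nonsquare : ¬ Square (- 1#)
    -1-nonsquare □-1 = m≢1+4k h (trans q≡1+2·count-nonzeroSquare (cong (λ k → suc (k ℕ.+ k)) pairs))
      where
      h : ℕ
      h = count (nonzeroSquare? ∩? lowerHalf? (-_))

      negate : ∀ {x} → NonzeroSquare x → NonzeroSquare (- x)
      negate {x} (x≢0 , □x) = -x≢0 x≢0 , subst Square (-1*x≈-x x) (square-*-square □-1 □x)

      pairs : count nonzeroSquare? ≡ h ℕ.+ h
      pairs = count-involution {f = -_} ⁻¹-involutive nonzeroSquare? negate (-x≢x ∘ proj₁)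

    -- If ab were a nonsquare, x ↦ a x would inject the nonzero squares into the
    -- nonsquares other than ab, although there are as many of the former as of the latter.
    nonsquare-*-nonsquare : ∀ {a b} → Nonsquare a → Nonsquare b → Square (a * b)
    nonsquare-*-nonsquare {a} {b} (a≢0 , ¬□a) (b≢0 , ¬□b) with square? (a * b)
    ... | yes □ab  = □ab
    ... | no  ¬□ab = ⊥-elim (ℕ.<-irrefl refl
      (ℕ.≤-<-trans embed (ℕ.<-≤-trans remove (ℕ.≤-reflexive count-nonsquare≡count-nonzeroSquare))))
      where
      Nonsquare∖ab : Pred Carrier 0ℓ
      Nonsquare∖ab = Nonsquare ∩ ∁ (_≡ a * b)

      nonsquare∖ab? : Decidable Nonsquare∖ab
      nonsquare∖ab? = nonsquare? ∩? ∁? (_≟ (a * b))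

      a*-maps : ∀ {x} → NonzeroSquare x → Nonsquare∖ab (a * x)
      a*-maps {x} (x≢0 , □x) =
        (x*y≢0 a≢0 x≢0 , λ □ax → square-*-nonsquare x≢0 □x ¬□a (subst Square (*-comm a x) □ax)) ,
        λ ax≡ab → ¬□b (subst Square (*-cancelˡ-≡ a≢0 ax≡ab) □x)

      embed : count nonzeroSquare? ≤ count nonsquare∖ab?
      embed = count-≤-injection nonzeroSquare? nonsquare∖ab? (a *_) a*-maps (λ _ _ → *-cancelˡ-≡ a≢0)

      remove : count nonsquare∖ab? < count nonsquare?
      remove = count-< nonsquare∖ab? nonsquare? proj₁ (x*y≢0 a≢0 b≢0 , ¬□ab) (λ (_ , ab≢ab) → ab≢ab refl)

    η-1≡-1 : η (- 1#) ≡ - 1#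
    η-1≡-1 with character (- 1#)
    ... | zero -1≡0         = contradiction -1≡0 (-x≢0 1≢0)
    ... | square _ □-1 _    = contradiction □-1 -1-nonsquare
    ... | nonsquare _ _ η-1 = η-1

    module _ {u : Carrier} (u≢0 : u ≢ 0#) (u≢1 : u ≢ 1#) (u≢-1 : u ≢ - 1#) where

      Δ : Carrier → Carrier
      Δ x = F₂ u (x + 1#) - F₂ u x

      Δ-poly : (s t b x v : Polynomial 2) → Polynomial 2
      Δ-poly s t b x v = (x :+ :1) :* (x :+ :1) :* (:1 :+ v :* t) :- x :* x :* (:1 :+ v :* s) :- b

      Δ-factor : ∀ {x s t b k e} → η x ≡ s → η (x + 1#) ≡ t → Δ x ≡ b →
                 (x + 1#) * (x + 1#) * (1# + u * t) - x * x * (1# + u * s) - b ≡ k * e → k ≢ 0# → e ≡ 0#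
      Δ-factor refl refl Δx≡b identity k≢0 =
        x≢0∧x*y≡0⇒y≡0 k≢0 (trans (sym identity) (x≈y⇒x∙y⁻¹≈ε Δx≡b))

      Δ0≡1+u : Δ 0# ≡ 1# + u
      Δ0≡1+u = begin
        F₂ u (0# + 1#) - F₂ u 0#       ≡⟨ cong₂ (λ y z → F₂ u y - z) (solve 0 (:0 :+ :1 := :1) refl) (F₂[0]≡0 u) ⟩
        1# * 1# * (1# + u * η 1#) - 0# ≡⟨ cong (λ v → 1# * 1# * (1# + u * v) - 0#) η1≡1 ⟩
        1# * 1# * (1# + u * 1#) - 0#   ≡⟨ solve 1 (λ u → :1 :* :1 :* (:1 :+ u :* :1) :- :0 := :1 :+ u) refl u ⟩
        1# + u                         ∎

      Δ-1≡u-1 : Δ (- 1#) ≡ u - 1#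
      Δ-1≡u-1 = begin
        F₂ u (- 1# + 1#) - F₂ u (- 1#)
          ≡⟨ cong (λ y → F₂ u y - F₂ u (- 1#)) (-‿inverseˡ 1#) ⟩
        F₂ u 0# - (- 1#) * (- 1#) * (1# + u * η (- 1#))
          ≡⟨ cong₂ (λ z v → z - (- 1#) * (- 1#) * (1# + u * v)) (F₂[0]≡0 u) η-1≡-1 ⟩
        0# - (- 1#) * (- 1#) * (1# + u * - 1#)
          ≡⟨ solve 1 (λ u → :0 :- (:- :1) :* (:- :1) :* (:1 :+ u :* (:- :1)) := u :- :1) refl u ⟩
        u - 1# ∎

      1+u≢0 : 1# + u ≢ 0#
      1+u≢0 1+u≡0 = u≢-1 (x+y≡0⇒x≡-y (trans (+-comm u 1#) 1+u≡0))

      1-u≢0 : 1# - u ≢ 0#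
      1-u≢0 1-u≡0 = u≢1 (sym (x-y≡0⇒x≡y 1-u≡0))

      u-1≢u+1 : u - 1# ≢ u + 1#
      u-1≢u+1 e = 2≢0 (begin
        1# + 1#                  ≡⟨ solve 1 (λ u → :1 :+ :1 := (u :+ :1) :- (u :- :1)) refl u ⟩
        (u + 1#) - (u - 1#)      ≡⟨ x≈y⇒x∙y⁻¹≈ε (sym e) ⟩
        0#                       ∎)

      1+u≢u-1 : 1# + u ≢ u - 1#
      1+u≢u-1 e = 2≢0 (begin
        1# + 1#                  ≡⟨ solve 1 (λ u → :1 :+ :1 := (:1 :+ u) :- (u :- :1)) refl u ⟩
        (1# + u) - (u - 1#)      ≡⟨ x≈y⇒x∙y⁻¹≈ε e ⟩
        0#                       ∎)

      Δ≡u+1⇒ : ∀ {x} → Δ x ≡ u + 1# →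
               x ≡ 0# ⊎ (¬ Square u × Linear u (1# + u) x) ⊎ (Square u × Linear (1# - u) (- u) x)
                      ⊎ Quadratic u (u - 1#) u x
      Δ≡u+1⇒ {x} Δx≡b with character x | character (x + 1#)
      ... | zero x≡0 | _ = inj₁ x≡0
      ... | _ | zero x+1≡0 =
        contradiction (trans (sym Δ-1≡u-1) (trans (cong Δ (sym (x+y≡0⇒x≡-y x+1≡0))) Δx≡b)) u-1≢u+1
      ... | square x≢0 _ ηx | square _ _ ηx+1 = contradiction (Δ-factor ηx ηx+1 Δx≡b
            (solve 2 (λ x u → Δ-poly :1 :1 (u :+ :1) x u := (:2 :* x) :* (:1 :+ u)) refl x u)
            (x*y≢0 2≢0 x≢0)) 1+u≢0
      ... | square _ _ ηx | nonsquare _ _ ηx+1 = inj₂ (inj₂ (inj₂ (Δ-factor ηx ηx+1 Δx≡b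
            (solve 2 (λ x u → Δ-poly :1 (:- :1) (u :+ :1) x u
                            := (:- :2) :* (u :* x :* x :+ (u :- :1) :* x :+ u)) refl x u)
            (-x≢0 2≢0))))
      ... | nonsquare x≢0 _ ηx | square _ □x+1 ηx+1 = inj₂ (inj₁ (¬□u , L))
        where
        L : Linear u (1# + u) x
        L = Δ-factor ηx ηx+1 Δx≡b
          (solve 2 (λ x u → Δ-poly (:- :1) :1 (u :+ :1) x u := (:2 :* x) :* (u :* x :+ (:1 :+ u))) refl x u)
          (x*y≢0 2≢0 x≢0)
        u[x+1]≡-1 : u * (x + 1#) ≡ - 1#
        u[x+1]≡-1 = x+y≡0⇒x≡-y (trans (solve 2 (λ x u → u :* (x :+ :1) :+ :1 := u :* x :+ (:1 :+ u)) refl x u) L)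
        ¬□u : ¬ Square u
        ¬□u □u = -1-nonsquare (subst Square u[x+1]≡-1 (square-*-square □u □x+1))
      ... | nonsquare x≢0 ¬□x ηx | nonsquare _ ¬□x+1 ηx+1 = inj₂ (inj₂ (inj₁ (□u , L)))
        where
        L : Linear (1# - u) (- u) x
        L = Δ-factor ηx ηx+1 Δx≡b
          (solve 2 (λ x u → Δ-poly (:- :1) (:- :1) (u :+ :1) x u := :2 :* ((:1 :- u) :* x :+ (:- u))) refl x u)
          2≢0
        [1-u]x≡u : (1# - u) * x ≡ u
        [1-u]x≡u = trans (x+y≡0⇒x≡-y L) (⁻¹-involutive u)
        [1-u][x+1]≡1 : (1# - u) * (x + 1#) ≡ 1#
        [1-u][x+1]≡1 = begin
          (1# - u) * (x + 1#)       ≡⟨ solve 2 (λ x u → (:1 :- u) :* (x :+ :1) := (:1 :- u) :* x :+ (:1 :- u)) refl x u ⟩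
          (1# - u) * x + (1# - u)   ≡⟨ cong (_+ (1# - u)) [1-u]x≡u ⟩
          u + (1# - u)              ≡⟨ solve 1 (λ u → u :+ (:1 :- u) := :1) refl u ⟩
          1#                        ∎
        ¬□1-u : ¬ Square (1# - u)
        ¬□1-u □1-u = square-*-nonsquare 1-u≢0 □1-u ¬□x+1 (subst Square (sym [1-u][x+1]≡1) 1-square)
        □u : Square u
        □u = subst Square [1-u]x≡u (nonsquare-*-nonsquare (1-u≢0 , ¬□1-u) (x≢0 , ¬□x))

      Δ≡u-1⇒ : ∀ {x} → Δ x ≡ u - 1# →
               x ≡ - 1# ⊎ (¬ Square u × Linear (1# + u) 1# x) ⊎ (Square u × Linear u 1# x)
                        ⊎ Quadratic u (u - 1#) (u - 1#) x
      Δ≡u-1⇒ {x} Δx≡b with character x | character (x + 1#)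
      ... | _ | zero x+1≡0 = inj₁ (x+y≡0⇒x≡-y x+1≡0)
      ... | zero x≡0 | _ = contradiction (trans (sym Δ0≡1+u) (trans (cong Δ (sym x≡0)) Δx≡b)) 1+u≢u-1
      ... | nonsquare _ _ ηx | nonsquare x+1≢0 _ ηx+1 = contradiction (Δ-factor ηx ηx+1 Δx≡b
            (solve 2 (λ x u → Δ-poly (:- :1) (:- :1) (u :- :1) x u := (:2 :* (x :+ :1)) :* (:1 :- u)) refl x u)
            (x*y≢0 2≢0 x+1≢0)) 1-u≢0
      ... | square _ _ ηx | nonsquare _ _ ηx+1 = inj₂ (inj₂ (inj₂ (Δ-factor ηx ηx+1 Δx≡b
            (solve 2 (λ x u → Δ-poly :1 (:- :1) (u :- :1) x u
                            := (:- :2) :* (u :* x :* x :+ (u :- :1) :* x :+ (u :- :1))) refl x u)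
            (-x≢0 2≢0))))
      ... | nonsquare x≢0 ¬□x ηx | square x+1≢0 _ ηx+1 = inj₂ (inj₂ (inj₁ (□u , L)))
        where
        L : Linear u 1# x
        L = Δ-factor ηx ηx+1 Δx≡b
          (solve 2 (λ x u → Δ-poly (:- :1) :1 (u :- :1) x u := (:2 :* (x :+ :1)) :* (u :* x :+ :1)) refl x u)
          (x*y≢0 2≢0 x+1≢0)
        ux≡-1 : u * x ≡ - 1#
        ux≡-1 = x+y≡0⇒x≡-y L
        □u : Square u
        □u = decidable-stable (square? u) λ ¬□u →
          -1-nonsquare (subst Square ux≡-1 (nonsquare-*-nonsquare (u≢0 , ¬□u) (x≢0 , ¬□x)))
      ... | square _ □x ηx | square x+1≢0 □x+1 ηx+1 = inj₂ (inj₁ (¬□u , L))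
        where
        L : Linear (1# + u) 1# x
        L = Δ-factor ηx ηx+1 Δx≡b
          (solve 2 (λ x u → Δ-poly :1 :1 (u :- :1) x u := :2 :* ((:1 :+ u) :* x :+ :1)) refl x u)
          2≢0
        [1+u]x≡-1 : (1# + u) * x ≡ - 1#
        [1+u]x≡-1 = x+y≡0⇒x≡-y L
        [x+1][1+u]≡u : (x + 1#) * (1# + u) ≡ u
        [x+1][1+u]≡u = begin
          (x + 1#) * (1# + u)       ≡⟨ solve 2 (λ x u → (x :+ :1) :* (:1 :+ u) := (:1 :+ u) :* x :+ (:1 :+ u)) refl x u ⟩
          (1# + u) * x + (1# + u)   ≡⟨ cong (_+ (1# + u)) [1+u]x≡-1 ⟩
          - 1# + (1# + u)           ≡⟨ solve 1 (λ u → :- :1 :+ (:1 :+ u) := u) refl u ⟩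
          u                         ∎
        ¬□1+u : ¬ Square (1# + u)
        ¬□1+u □1+u = -1-nonsquare (subst Square [1+u]x≡-1 (square-*-square □1+u □x))
        ¬□u : ¬ Square u
        ¬□u □u = square-*-nonsquare x+1≢0 □x+1 ¬□1+u (subst Square (sym [x+1][1+u]≡u) □u)

      δ-u+1≤4 : δ₁ (F₂ u) (u + 1#) ≤ 4
      δ-u+1≤4 = count-≤4 (λ x → Δ x ≟ (u + 1#)) (square? u) 0# u≢0 1-u≢0 u≢0 Δ≡u+1⇒

      δ-u-1≤4 : δ₁ (F₂ u) (u - 1#) ≤ 4
      δ-u-1≤4 = count-≤4 (λ x → Δ x ≟ (u - 1#)) (square? u) (- 1#) 1+u≢0 u≢0 u≢0 Δ≡u-1⇒

lemma16 : (p n q : ℕ) → Prime p → ¬ (p ≡ 2) → q ≡ p ^ n → q % 4 ≡ 3 →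
          (𝔽 : FiniteField q) →
          let open FiniteField 𝔽 in
          (u : Carrier) → ¬ (u ≡ 0#) → ¬ (u ≡ 1#) → ¬ (u ≡ - 1#) →
          (δ₁ (F₂ u) (u + 1#) ≤ 4) × (δ₁ (F₂ u) (u - 1#) ≤ 4)
lemma16 _ _ _ _ _ _ q%4≡3 𝔽 u u≢0 u≢1 u≢-1 =
  δ-u+1≤4 q%4≡3 u≢0 u≢1 u≢-1 , δ-u-1≤4 q%4≡3 u≢0 u≢1 u≢-1
  where open FiniteFieldFacts 𝔽
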